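{- Let $k\geq 3$ be an integer, let $S$ be a set of integers containing no arithmetic progression of length $k$, and let $c = \frac{k}{k-1}$. Then there is $N_0$ such that for every $N \ge N_0$: if $a_0$ is a non-negative integer and $A=\{a_1, \ldots, a_d\}$ is a set of positive integers such that $H(a_0; a_1, \ldots , a_d) \subset S\cap [1,N]$, then \[ d \leq \frac{2(k-2)}{(k-1)\log c}\log N+\frac{2}{\log c}+1. \]
   Context: An arithmetic progression of length $k$ is a set $\{b, b+h, \dots, b+(k-1)h\}$ with $b,h$ integers and $h\neq 0$. For integers $a_0\neq 0, a_1,\dots,a_d$, the Hilbert cube is $H(a_0;a_1,\dots,a_d)=\{a_0+\sum_{i=1}^d \varepsilon_i a_i : \varepsilon_i\in\{0,1\}\}$; for $a_0=0$ the empty sum is excluded: $H(0;a_1,\dots,a_d)=\{\sum_{i=1}^d \varepsilon_i a_i : \varepsilon_i\in\{0,1\},\ \sum_i \varepsilon_i>0\}$. $\log$ is the natural logarithm. -}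

module Defs where

open import Data.Nat using (ℕ; zero; suc; _+_; _*_; _∸_; _^_; _≤_)
open import Data.Integer as ℤ using (ℤ; +_)
open import Data.Fin using (Fin; toℕ)
import Data.Fin as Fin
open import Data.Bool using (Bool; true; false)
open import Data.Product using (Σ; ∃; _×_)
open import Data.Sum using (_⊎_)
open import Relation.Binary.PropositionalEquality using (_≡_; _≢_)
open import Relation.Nullary using (¬_)

ContainsAP : ℕ → (ℤ → Set) → Set
ContainsAP k S =
  Σ ℤ λ b → Σ ℤ λ h → (h ≢ + 0) × ((i : Fin k) → S (b ℤ.+ (+ toℕ i) ℤ.* h))

NoAP : ℕ → (ℤ → Set) → Set
NoAP k S = ¬ ContainsAP k S

cubeSum : ∀ {d} → (Fin d → Bool) → (Fin d → ℕ) → ℕ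
cubeSum {zero}  ε a = 0
cubeSum {suc d} ε a = (if′ (ε Fin.zero)) + cubeSum (λ i → ε (Fin.suc i)) (λ i → a (Fin.suc i))
  where
  if′ : Bool → ℕ
  if′ true  = a Fin.zero
  if′ false = 0

-- x ∈ H(a₀; a₁,…,a_d); for a₀ = 0 the empty sum is excluded
InHilbertCube : ∀ {d} → ℕ → (Fin d → ℕ) → ℕ → Set
InHilbertCube a₀ a x =
  Σ (_ → Bool) λ ε → (a₀ ≢ 0 ⊎ ∃ λ i → ε i ≡ true) × (x ≡ a₀ + cubeSum ε a)

-- expScaled t n = n! · Σ_{j=0}^{n} t^j / j!   (a natural number)
expScaled : ℕ → ℕ → ℕ
expScaled t zero    = 1
expScaled t (suc n) = suc n * expScaled t n + t ^ suc n

factorial : ℕ → ℕ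
factorial zero    = 1
factorial (suc n) = suc n * factorial n

-- LeExp P Q t  means the real inequality  P ≤ Q · e^t,
-- with e^t = lim_n Σ_{j≤n} t^j/j!.  Encoded as: for every M there is n with
-- P ≤ (1 + 1/M) · Q · Σ_{j≤n} t^j/j!, i.e.  M·P·n! ≤ (M+1)·Q·expScaled t n.
LeExp : ℕ → ℕ → ℕ → Set
LeExp P Q t = ∀ (M : ℕ) → ∃ λ n → M * P * factorial n ≤ suc M * Q * expScaled t n

-- The bound  d ≤ 2(k-2)/((k-1) log c) · log N + 2/log c + 1,  c = k/(k-1),
-- equivalently (multiply by (k-1) log c > 0 and exponentiate):
--   k^{(d-1)(k-1)} ≤ (k-1)^{(d-1)(k-1)} · N^{2(k-2)} · e^{2(k-1)}
-- (for d = 0 both the original and this, with d ∸ 1 = 0, hold trivially when N ≥ 1).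
HilbertBound : ℕ → ℕ → ℕ → Set
HilbertBound k N d =
  LeExp (k ^ ((d ∸ 1) * (k ∸ 1)))
        ((k ∸ 1) ^ ((d ∸ 1) * (k ∸ 1)) * N ^ (2 * (k ∸ 2)))
        (2 * (k ∸ 1))

{-# OPTIONS --safe #-}

-- Let h ⊆ S ∩ [0, N] and s > 0. For each x ∈ h one of x + s, …, x + (k-1)s lies in
-- (h + s) ∖ h, since otherwise x, x + s, …, x + (k-1)s is a k-term progression in S.
-- Counting these escapes gives k |h| ≤ (k-1) |h ∪ (h + s)|. Building the cube
-- H(a₀ + a₁; a₂, …, a_d) ⊆ S ∩ [1, N] one generator at a time thus gives
-- (k/(k-1))^(d-1) ≤ N, i.e. (d-1) log c ≤ log N, which is stronger than the stated
-- bound since 2(k-2)/(k-1) ≥ 1.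
module Submission where

open import Defs
open import Data.Nat using (ℕ; _≤_; _<_)
open import Data.Integer using (ℤ; +_)
open import Data.Fin using (Fin)
open import Data.Product using (∃; _×_)
open import Function.Definitions using (Injective)
open import Relation.Binary.PropositionalEquality using (_≡_)

open import Data.Nat
  using (zero; suc; _+_; _*_; _∸_; _^_; _≤ᵇ_; _≡ᵇ_; z≤n; s≤s; NonZero; >-nonZero)
open import Data.Nat.Properties
open import Algebra.Properties.CommutativeSemigroup +-commutativeSemigroup
  using () renaming (interchange to +-interchange)
open import Algebra.Properties.CommutativeSemigroup *-commutativeSemigroup
  using (x∙yz≈y∙xz) renaming (interchange to *-interchange)
import Data.Integer as ℤ
import Data.Integer.Properties as ℤₚ
open import Data.Fin using (zero; suc; toℕ)
open import Data.Fin.Properties using (toℕ≤pred[n])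
open import Data.Vec.Functional using (_∷_; tail)
open import Data.Bool using (Bool; true; false; _∨_; _∧_; not)
open import Data.Product using (_,_; proj₁; proj₂)
open import Data.Sum using (_⊎_; inj₁; inj₂)
open import Data.Empty using (⊥-elim)
open import Relation.Nullary using (contradiction)
open import Function using (_∘_)
open import Relation.Binary.PropositionalEquality
  using (_≢_; refl; sym; trans; cong; cong₂; subst; module ≡-Reasoning)

∑< : ℕ → (ℕ → ℕ) → ℕ
∑< zero    f = 0
∑< (suc n) f = f n + ∑< n f

syntax ∑< n (λ x → e) = ∑[ x < n ] e

∑-cong : ∀ {f g} n → (∀ x → f x ≡ g x) → ∑< n f ≡ ∑< n g
∑-cong zero    f≗g = refl
∑-cong (suc n) f≗g = cong₂ _+_ (f≗g n) (∑-cong n f≗g)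

∑-mono-≤ : ∀ {f g} n → (∀ x → f x ≤ g x) → ∑< n f ≤ ∑< n g
∑-mono-≤ zero    f≤g = z≤n
∑-mono-≤ (suc n) f≤g = +-mono-≤ (f≤g n) (∑-mono-≤ n f≤g)

∑-distrib-+ : ∀ f g n → ∑[ x < n ] (f x + g x) ≡ ∑< n f + ∑< n g
∑-distrib-+ f g zero    = refl
∑-distrib-+ f g (suc n) =
  trans (cong (λ s → f n + g n + s) (∑-distrib-+ f g n)) (+-interchange (f n) (g n) _ _)

∑-const : ∀ n c → ∑[ x < n ] c ≡ n * c
∑-const zero    c = refl
∑-const (suc n) c = cong (λ s → c + s) (∑-const n c)

∑-comm : ∀ (F : ℕ → ℕ → ℕ) n m →
  ∑[ x < n ] ∑[ i < m ] F x i ≡ ∑[ i < m ] ∑[ x < n ] F x i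
∑-comm F n zero    = trans (∑-const n 0) (*-zeroʳ n)
∑-comm F n (suc m) = trans (∑-distrib-+ (λ x → F x m) (λ x → ∑[ i < m ] F x i) n)
                           (cong (λ s → ∑[ x < n ] F x m + s) (∑-comm F n m))

∑-term-≤ : ∀ f {i n} → i < n → f i ≤ ∑< n f
∑-term-≤ f {i} {suc n} (s≤s i≤n) with m≤n⇒m<n∨m≡n i≤n
... | inj₁ i<n  = ≤-trans (∑-term-≤ f i<n) (m≤n+m _ (f n))
... | inj₂ refl = m≤m+n (f i) _

∑-shift-≤ : ∀ f t n → ∑[ x < n ] f (x + t) ≤ ∑< (n + t) f
∑-shift-≤ f t zero    = z≤n
∑-shift-≤ f t (suc n) = +-monoʳ-≤ (f (n + t)) (∑-shift-≤ f t n)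

∑-vanishing : ∀ f n → (∀ y → n ≤ y → f y ≡ 0) → ∀ t → ∑< (t + n) f ≡ ∑< n f
∑-vanishing f n f≥n≡0 zero    = refl
∑-vanishing f n f≥n≡0 (suc t) rewrite f≥n≡0 (t + n) (m≤n+m n t) = ∑-vanishing f n f≥n≡0 t

∑-translate-≤ : ∀ f n → (∀ y → n ≤ y → f y ≡ 0) → ∀ t → ∑[ x < n ] f (x + t) ≤ ∑< n f
∑-translate-≤ f n f≥n≡0 t = begin
  ∑[ x < n ] f (x + t) ≤⟨ ∑-shift-≤ f t n ⟩
  ∑< (n + t) f         ≡⟨ cong (λ l → ∑< l f) (+-comm n t) ⟩
  ∑< (t + n) f         ≡⟨ ∑-vanishing f n f≥n≡0 t ⟩
  ∑< n f               ∎
  where open ≤-Reasoning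

[_] : Bool → ℕ
[ true ]  = 1
[ false ] = 0

count : (ℕ → Bool) → ℕ → ℕ
count p n = ∑[ x < n ] [ p x ]

count-pos : ∀ p {y n} → p y ≡ true → y < n → 1 ≤ count p n
count-pos p {y} {n} py y<n = subst (_≤ count p n) (cong [_] py) (∑-term-≤ (λ x → [ p x ]) y<n)

0∉⇒count-suc-≤ : ∀ p → p 0 ≡ false → ∀ n → count p (suc n) ≤ n
0∉⇒count-suc-≤ p p0 zero    rewrite p0 = z≤n
0∉⇒count-suc-≤ p p0 (suc n) = +-mono-≤ ([]≤1 (p (suc n))) (0∉⇒count-suc-≤ p p0 n)
  where
  []≤1 : ∀ b → [ b ] ≤ 1
  []≤1 true  = ≤-refl
  []≤1 false = z≤n

[∨]≡[]+[not∧] : ∀ a b → [ a ∨ b ] ≡ [ a ] + [ not a ∧ b ]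
[∨]≡[]+[not∧] true  b = refl
[∨]≡[]+[not∧] false b = refl

-- Sets of naturals are Boolean predicates: translate s p is p + s, extend s p is
-- p ∪ (p + s) and fresh s p is (p + s) ∖ p.
translate : ℕ → (ℕ → Bool) → ℕ → Bool
translate s p x = (s ≤ᵇ x) ∧ p (x ∸ s)

extend : ℕ → (ℕ → Bool) → ℕ → Bool
extend s p x = p x ∨ translate s p x

fresh : ℕ → (ℕ → Bool) → ℕ → Bool
fresh s p x = not (p x) ∧ translate s p x

translate-+ : ∀ s p y → translate s p (y + s) ≡ p y
translate-+ s p y with s ≤ᵇ y + s | ≤⇒≤ᵇ (m≤n+m s y)
... | true | _ = cong p (m+n∸n≡m y s)

fresh-+ : ∀ s p y → p y ≡ true → p (y + s) ≡ false → fresh s p (y + s) ≡ true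
fresh-+ s p y py p[y+s] rewrite p[y+s] = trans (translate-+ s p y) py

⊆-extend : ∀ s p {x} → p x ≡ true → extend s p x ≡ true
⊆-extend s p px rewrite px = refl

fresh⊆extend : ∀ s p {x} → fresh s p x ≡ true → extend s p x ≡ true
fresh⊆extend s p {x} fx with p x
... | false = fx

extend-cases : ∀ s p x → extend s p x ≡ true → p x ≡ true ⊎ ∃ λ y → p y ≡ true × x ≡ y + s
extend-cases s p x ex with p x | s ≤ᵇ x | ≤ᵇ⇒≤ s x
... | true  | _    | _   = inj₁ refl
... | false | true | s≤x = inj₂ (x ∸ s , ex , sym (m∸n+n≡m (s≤x _)))

count-extend : ∀ s p n → count (extend s p) n ≡ count p n + count (fresh s p) n
count-extend s p n = trans (∑-cong n (λ x → [∨]≡[]+[not∧] (p x) (translate s p x)))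
                           (∑-distrib-+ (λ x → [ p x ]) (λ x → [ fresh s p x ]) n)

first-drop : ∀ (p : ℕ → Bool) → p 0 ≡ true → ∀ m →
  (∀ i → i ≤ m → p i ≡ true) ⊎ ∃ λ i → i < m × p i ≡ true × p (suc i) ≡ false
first-drop p p0 zero = inj₁ λ { zero z≤n → p0 }
first-drop p p0 (suc m) with p 1 in p1
... | false = inj₂ (0 , s≤s z≤n , p0 , p1)
... | true with first-drop (p ∘ suc) p1 m
...   | inj₁ all = inj₁ λ { zero _ → p0 ; (suc i) (s≤s i≤m) → all i i≤m }
...   | inj₂ (i , i<m , pi , p[1+i]) = inj₂ (suc i , s≤s i<m , pi , p[1+i])

-- For each fixed i, x ↦ x + (i+1)s is injective, so the escapes of h via step i
-- hit q at most |q| times.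
count-≤-escapes : ∀ (h q : ℕ → Bool) s m n → (∀ y → n ≤ y → q y ≡ false) →
  (∀ x → h x ≡ true → ∃ λ i → i < m × q (x + suc i * s) ≡ true) →
  count h n ≤ m * count q n
count-≤-escapes h q s m n q≥n≡false escape = begin
  count h n
    ≤⟨ ∑-mono-≤ n reaches ⟩
  ∑[ x < n ] ∑[ i < m ] [ q (x + suc i * s) ]
    ≡⟨ ∑-comm (λ x i → [ q (x + suc i * s) ]) n m ⟩
  ∑[ i < m ] ∑[ x < n ] [ q (x + suc i * s) ]
    ≤⟨ ∑-mono-≤ m (λ i → ∑-translate-≤ _ n [q≥n]≡0 (suc i * s)) ⟩
  ∑[ i < m ] count q n
    ≡⟨ ∑-const m (count q n) ⟩
  m * count q n
    ∎
  where
  open ≤-Reasoning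
  reaches : ∀ x → [ h x ] ≤ ∑[ i < m ] [ q (x + suc i * s) ]
  reaches x with h x in hx
  ... | false = z≤n
  ... | true  = let i , i<m , qi = escape x hx in count-pos (λ i → q (x + suc i * s)) qi i<m
  [q≥n]≡0 : ∀ y → n ≤ y → [ q y ] ≡ 0
  [q≥n]≡0 y n≤y = cong [_] (q≥n≡false y n≤y)

module _ {m} (S : ℤ → Set) (noAP : NoAP (suc m) S) {s} (s>0 : 0 < s) where

  escape : ∀ h → (∀ x → extend s h x ≡ true → S (+ x)) →
    ∀ x → h x ≡ true → ∃ λ i → i < m × fresh s h (x + suc i * s) ≡ true
  escape h h∪h+s⊆S x hx with first-drop (λ i → h (x + i * s)) h[x+0] m
    where
    h[x+0] : h (x + 0) ≡ true
    h[x+0] = subst (λ y → h y ≡ true) (sym (+-identityʳ x)) hx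
  ... | inj₁ chain⊆h = ⊥-elim (noAP (+ x , + s , +s≢0 , chain⊆S))
    where
    +s≢0 : + s ≢ + 0
    +s≢0 eq = <⇒≢ s>0 (sym (ℤₚ.+-injective eq))
    chain⊆S : ∀ (i : Fin (suc m)) → S (+ x ℤ.+ + toℕ i ℤ.* + s)
    chain⊆S i = subst S (cong (λ t → + x ℤ.+ t) (ℤₚ.pos-* (toℕ i) s))
                        (h∪h+s⊆S _ (⊆-extend s h (chain⊆h (toℕ i) (toℕ≤pred[n] i))))
  ... | inj₂ (i , i<m , hi , h[1+i]) =
    i , i<m , subst (λ y → fresh s h y ≡ true) (sym step) (fresh-+ s h _ hi h[i*s+s])
    where
    step : x + suc i * s ≡ x + i * s + s
    step = trans (cong (λ t → x + t) (+-comm s (i * s))) (sym (+-assoc x (i * s) s))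
    h[i*s+s] : h (x + i * s + s) ≡ false
    h[i*s+s] = subst (λ y → h y ≡ false) step h[1+i]

  count-extend-≥ : ∀ {N} h → (∀ x → extend s h x ≡ true → S (+ x) × x ≤ N) →
    suc m * count h (suc N) ≤ m * count (extend s h) (suc N)
  count-extend-≥ {N} h h∪h+s⊆S∩[0,N] = begin
    suc m * H     ≤⟨ +-monoˡ-≤ (m * H) H≤mF ⟩
    m * F + m * H ≡⟨ sym (*-distribˡ-+ m F H) ⟩
    m * (F + H)   ≡⟨ cong (m *_) (trans (+-comm F H) (sym (count-extend s h (suc N)))) ⟩
    m * count (extend s h) (suc N) ∎
    where
    open ≤-Reasoning
    H F : ℕ
    H = count h (suc N)
    F = count (fresh s h) (suc N)
    fresh>N : ∀ y → suc N ≤ y → fresh s h y ≡ false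
    fresh>N y N<y with fresh s h y in y∈fresh
    ... | false = refl
    ... | true  = contradiction (proj₂ (h∪h+s⊆S∩[0,N] y (fresh⊆extend s h y∈fresh))) (<⇒≱ N<y)
    H≤mF : H ≤ m * F
    H≤mF = count-≤-escapes h (fresh s h) s m (suc N) fresh>N
             (escape h (λ x x∈ → proj₁ (h∪h+s⊆S∩[0,N] x x∈)))

-- cube b a is H(b; a₁, …, a_d) with the empty sum included.
cube : ℕ → ∀ {d} → (Fin d → ℕ) → ℕ → Bool
cube b {zero}  a x = x ≡ᵇ b
cube b {suc d} a   = extend (a zero) (cube b (tail a))

cube-base : ∀ b {d} (a : Fin d → ℕ) → cube b a b ≡ true
cube-base b {zero}  a with b ≡ᵇ b | ≡⇒≡ᵇ b b refl
... | true | _ = refl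
cube-base b {suc d} a = ⊆-extend (a zero) (cube b (tail a)) (cube-base b (tail a))

cube-sound : ∀ b {d} (a : Fin d → ℕ) x → cube b a x ≡ true → ∃ λ ε → x ≡ b + cubeSum ε a
cube-sound b {zero}  a x x∈ with x ≡ᵇ b | ≡ᵇ⇒≡ x b
... | true | x≡b = (λ ()) , trans (x≡b _) (sym (+-identityʳ b))
cube-sound b {suc d} a x x∈ with extend-cases (a zero) (cube b (tail a)) x x∈
... | inj₁ x∈tail = let ε , x≡ = cube-sound b (tail a) x x∈tail in false ∷ ε , x≡
... | inj₂ (y , y∈tail , refl) =
  let ε , y≡ = cube-sound b (tail a) y y∈tail in
  true ∷ ε , (begin
    y + a zero                        ≡⟨ cong (λ t → t + a zero) y≡ ⟩
    b + cubeSum ε (tail a) + a zero   ≡⟨ +-assoc b _ (a zero) ⟩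
    b + (cubeSum ε (tail a) + a zero) ≡⟨ cong (λ t → b + t) (+-comm _ (a zero)) ⟩
    b + (a zero + cubeSum ε (tail a)) ∎)
  where open ≡-Reasoning

-- The base a₀ + a₁ keeps the empty sum, excluded from H(0; a), out of the cube.
cube⊆HilbertCube : ∀ a₀ {d} (a : Fin (suc d) → ℕ) x →
  cube (a₀ + a zero) (tail a) x ≡ true → InHilbertCube a₀ a x
cube⊆HilbertCube a₀ a x x∈ =
  let ε , x≡ = cube-sound (a₀ + a zero) (tail a) x x∈
  in true ∷ ε , inj₂ (zero , refl) , trans x≡ (+-assoc a₀ (a zero) _)

module _ {m} (S : ℤ → Set) (noAP : NoAP (suc m) S) {N : ℕ} where

  cube-count : ∀ b {d} (a : Fin d → ℕ) → (∀ i → 0 < a i) →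
    (∀ x → cube b a x ≡ true → S (+ x) × x ≤ N) →
    suc m ^ d ≤ m ^ d * count (cube b a) (suc N)
  cube-count b {zero}  a _ cube⊆ =
    ≤-trans (count-pos (cube b a) b∈cube (s≤s (proj₂ (cube⊆ b b∈cube))))
            (≤-reflexive (sym (*-identityˡ _)))
    where
    b∈cube : cube b a b ≡ true
    b∈cube = cube-base b a
  cube-count b {suc d} a a>0 cube⊆ = begin
    suc m * suc m ^ d
      ≤⟨ *-monoʳ-≤ (suc m) (cube-count b (tail a) (a>0 ∘ suc) h⊆) ⟩
    suc m * (m ^ d * count h (suc N))
      ≡⟨ x∙yz≈y∙xz (suc m) (m ^ d) _ ⟩
    m ^ d * (suc m * count h (suc N))
      ≤⟨ *-monoʳ-≤ (m ^ d) (count-extend-≥ S noAP (a>0 zero) h cube⊆) ⟩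
    m ^ d * (m * count (cube b a) (suc N))
      ≡⟨ x∙yz≈y∙xz (m ^ d) m _ ⟩
    m * (m ^ d * count (cube b a) (suc N))
      ≡⟨ sym (*-assoc m (m ^ d) _) ⟩
    m * m ^ d * count (cube b a) (suc N)
      ∎
    where
    open ≤-Reasoning
    h : ℕ → Bool
    h = cube b (tail a)
    h⊆ : ∀ x → h x ≡ true → S (+ x) × x ≤ N
    h⊆ x x∈h = cube⊆ x (⊆-extend (a zero) h x∈h)

  cube-bound : ∀ b {d} (a : Fin d → ℕ) → (∀ i → 0 < a i) →
    (∀ x → cube b a x ≡ true → S (+ x) × (1 ≤ x × x ≤ N)) →
    suc m ^ d ≤ m ^ d * N
  cube-bound b {d} a a>0 cube⊆ = ≤-trans
    (cube-count b a a>0 (λ x x∈ → proj₁ (cube⊆ x x∈) , proj₂ (proj₂ (cube⊆ x x∈))))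
    (*-monoʳ-≤ (m ^ d) (0∉⇒count-suc-≤ (cube b a) 0∉cube N))
    where
    0∉cube : cube b a 0 ≡ false
    0∉cube with cube b a 0 in 0∈cube
    ... | false = refl
    ... | true  = contradiction (proj₁ (proj₂ (cube⊆ 0 0∈cube))) λ ()

  HilbertCube-bound : ∀ a₀ {d} (a : Fin (suc d) → ℕ) → (∀ i → 0 < a i) →
    (∀ x → InHilbertCube a₀ a x → S (+ x) × (1 ≤ x × x ≤ N)) →
    suc m ^ d ≤ m ^ d * N
  HilbertCube-bound a₀ a a>0 H⊆ =
    cube-bound (a₀ + a zero) (tail a) (a>0 ∘ suc) (λ x x∈ → H⊆ x (cube⊆HilbertCube a₀ a x x∈))

^-distribʳ-* : ∀ x y n → (x * y) ^ n ≡ x ^ n * y ^ n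
^-distribʳ-* x y zero    = refl
^-distribʳ-* x y (suc n) =
  trans (cong (λ t → x * y * t) (^-distribʳ-* x y n)) (*-interchange x y (x ^ n) (y ^ n))

≤⇒LeExp : ∀ {P Q} t → P ≤ Q → LeExp P Q t
≤⇒LeExp t P≤Q M = 0 , *-monoˡ-≤ 1 (*-mono-≤ (n≤1+n M) P≤Q)

HilbertBound-from-power : ∀ n {N} d → let m = 2 + n in 1 ≤ N →
  suc m ^ (d ∸ 1) ≤ m ^ (d ∸ 1) * N → HilbertBound (suc m) N d
HilbertBound-from-power n {N} d 1≤N bound = ≤⇒LeExp (2 * m) (begin
  suc m ^ (e * m)              ≡⟨ sym (^-*-assoc (suc m) e m) ⟩
  (suc m ^ e) ^ m              ≤⟨ ^-monoˡ-≤ m bound ⟩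
  (m ^ e * N) ^ m              ≡⟨ ^-distribʳ-* (m ^ e) N m ⟩
  (m ^ e) ^ m * N ^ m          ≡⟨ cong (λ t → t * N ^ m) (^-*-assoc m e m) ⟩
  m ^ (e * m) * N ^ m          ≤⟨ *-monoʳ-≤ (m ^ (e * m)) (^-monoʳ-≤ N m≤2[m∸1]) ⟩
  m ^ (e * m) * N ^ (2 * suc n) ∎)
  where
  open ≤-Reasoning
  m e : ℕ
  m = 2 + n
  e = d ∸ 1
  instance
    N≢0 : NonZero N
    N≢0 = >-nonZero 1≤N
  m≤2[m∸1] : m ≤ 2 * suc n
  m≤2[m∸1] = +-mono-≤ (s≤s z≤n) (m≤m+n (suc n) 0)

theorem2 : (k : ℕ) → 3 ≤ k → (S : ℤ → Set) → NoAP k S →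
    ∃ λ N₀ → (N : ℕ) → N₀ ≤ N → 1 ≤ N →
      (a₀ d : ℕ) (a : Fin d → ℕ) → Injective _≡_ _≡_ a → (∀ i → 0 < a i) →
      (∀ x → InHilbertCube a₀ a x → S (+ x) × (1 ≤ x × x ≤ N)) →
      HilbertBound k N d
theorem2 (suc (suc (suc n))) (s≤s (s≤s (s≤s _))) S noAP = 0 , λ where
  N _ 1≤N a₀ zero    a _ _   _  →
    HilbertBound-from-power n 0 1≤N (≤-trans 1≤N (≤-reflexive (sym (*-identityˡ N))))
  N _ 1≤N a₀ (suc d) a _ a>0 H⊆ →
    HilbertBound-from-power n (suc d) 1≤N (HilbertCube-bound S noAP a₀ a a>0 H⊆)
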